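{- Let $N$ be a project and let $k\ge 1$ be an integer with $k\le k_{\max}(N)$. Suppose the greedy algorithm, run on $N$ and $k$, produces the plan $G=A_1\uplus\cdots\uplus A_k$ (at iteration $i$, $A_i$ is a minimum-cost $1$-crashing plan of the accelerated project $N(A_1\uplus\cdots\uplus A_{i-1})$). Let $\mathsf{OPT}$ be a minimum-cost $k$-crashing plan of $N$. Then $$\mathrm{cost}(G)\le \Big(\sum_{i=1}^{k}\frac{1}{i}\Big)\,\mathrm{cost}(\mathsf{OPT}).$$
   Context: A project is a finite directed acyclic graph $N=(V,E)$ with a unique source $s$ (no incoming edges) and a unique sink $t$ (no outgoing edges). Each edge (job) $e_i\in E$ has three attributes $(a_i,b_i,c_i)$: integers $0\le a_i\le b_i$ and a cost rate $c_i\ge 0$. The length of $e_i$ is $b_i$. A path of $N$ means a directed path from $s$ to $t$, and its length is the sum of the lengths of its edges. The duration $d(N)$ is the maximum length of a path. An (accelerate) plan $X$ is a multiset of edges of $N$ in which $e_i$ has multiplicity $x_i$ with $0\le x_i\le b_i-a_i$; its cost is $\mathrm{cost}(X)=\sum_i c_i x_i$. The accelerated project $N(X)$ is the project obtained from $N$ by replacing each $b_i$ by $b_i-x_i$ (so a plan for $N(X)$ may use $e_i$ with multiplicity at most $b_i-x_i-a_i$). A plan $X$ is $k$-crashing for $N$ if the duration is shortened by $k$, i.e. $d(N(X))=d(N)-k$. Let $E_{b\setminus a}$ denote the plan in which each $e_i$ has multiplicity $b_i-a_i$, and $k_{\max}(N)=d(N)-d(N(E_{b\setminus a}))$. Greedy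 algorithm: set $G=\varnothing$; for $i=1,\dots,k$, let $A_i$ be a minimum-cost $1$-crashing plan of $N(G)$ and set $G\leftarrow G\uplus A_i$ (multiset union).
   Formalization: The cost rates $c_i$ of the jobs take values in the nonnegative rationals. -}

module Defs where

open import Data.Nat as ℕ using (ℕ; zero; suc; _∸_)
open import Data.Fin using (Fin; zero; suc)
open import Data.List using (List; []; _∷_; map)
open import Data.Nat.ListAction using (sum)
open import Data.Product using (Σ; ∃; ∃-syntax; _×_; _,_)
open import Data.Integer using (+_)
open import Data.Rational as ℚ using (ℚ; 0ℚ; _/_)
open import Relation.Binary.PropositionalEquality using (_≡_; _≢_)
open import Relation.Nullary using (¬_)

sumℕ : (m : ℕ) → (Fin m → ℕ) → ℕ
sumℕ zero    f = 0
sumℕ (suc m) f = f zero ℕ.+ sumℕ m (λ i → f (suc i))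

sumℚ : (m : ℕ) → (Fin m → ℚ) → ℚ
sumℚ zero    f = 0ℚ
sumℚ (suc m) f = f zero ℚ.+ sumℚ m (λ i → f (suc i))

toℚ : ℕ → ℚ
toℚ n = + n / 1

harmonic : ℕ → ℚ
harmonic zero    = 0ℚ
harmonic (suc k) = harmonic k ℚ.+ (+ 1 / suc k)

module _ {n m : ℕ} (src tgt : Fin m → Fin n) where
  IsWalk : Fin n → List (Fin m) → Fin n → Set
  IsWalk u []       v = u ≡ v
  IsWalk u (e ∷ es) v = src e ≡ u × IsWalk (tgt e) es v

record Project : Set where
  field
    n m     : ℕ
    src tgt : Fin m → Fin n
    s t     : Fin n
    a b     : Fin m → ℕ
    c       : Fin m → ℚ
    a≤b     : ∀ e → a e ℕ.≤ b e
    c≥0     : ∀ e → 0ℚ ℚ.≤ c e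
    acyclic : ∀ u e es → ¬ IsWalk src tgt u (e ∷ es) u
    s-source : ∀ e → tgt e ≢ s
    s-unique : ∀ v → v ≢ s → ∃[ e ] tgt e ≡ v
    t-sink   : ∀ e → src e ≢ t
    t-unique : ∀ v → v ≢ t → ∃[ e ] src e ≡ v

module _ (N : Project) where
  open Project N

  Lengths : Set
  Lengths = Fin m → ℕ

  Plan : Set
  Plan = Fin m → ℕ

  IsPath : List (Fin m) → Set
  IsPath es = IsWalk src tgt s es t

  pathLength : Lengths → List (Fin m) → ℕ
  pathLength ℓ es = sum (map ℓ es)

  IsDuration : Lengths → ℕ → Set
  IsDuration ℓ D = (∃[ es ] (IsPath es × pathLength ℓ es ≡ D))
                 × (∀ es → IsPath es → pathLength ℓ es ℕ.≤ D)

  accel : Lengths → Plan → Lengths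
  accel ℓ x e = ℓ e ∸ x e

  ValidPlan : Lengths → Plan → Set
  ValidPlan ℓ x = ∀ e → x e ℕ.≤ ℓ e ∸ a e

  cost : Plan → ℚ
  cost x = sumℚ m (λ e → c e ℚ.* toℚ (x e))

  Crashing : Lengths → ℕ → Plan → Set
  Crashing ℓ k x = ∃[ D ] ∃[ D' ] (IsDuration ℓ D × IsDuration (accel ℓ x) D' × D' ℕ.+ k ≡ D)

  MinCostCrashing : Lengths → ℕ → Plan → Set
  MinCostCrashing ℓ k x =
    ValidPlan ℓ x × Crashing ℓ k x ×
    (∀ y → ValidPlan ℓ y → Crashing ℓ k y → cost x ℚ.≤ cost y)

  Eba : Plan
  Eba e = b e ∸ a e

  IsKMax : ℕ → Set
  IsKMax K = ∃[ D ] ∃[ D' ] (IsDuration b D × IsDuration (accel b Eba) D' × K ℕ.+ D' ≡ D)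

  -- G_i = A_0 ⊎ ... ⊎ A_{i-1}  (multiset union = pointwise sum of multiplicities)
  greedyPrefix : (ℕ → Plan) → ℕ → Plan
  greedyPrefix A zero    e = 0
  greedyPrefix A (suc i) e = greedyPrefix A i e ℕ.+ A i e

{-# OPTIONS --safe #-}
-- For i < k let Gᵢ = A₀ ⊎ ⋯ ⊎ Aᵢ₋₁, so that N(Gᵢ) has duration d(N) - i.  The residual plan
-- Y = OPT ∸ Gᵢ of N(Gᵢ) still shortens every path by j = k - i, and the heart of the proof is
-- that then some 1-crashing plan of N(Gᵢ) costs at most cost(Y)/j ≤ cost(OPT)/(k - i); as Aᵢ
-- is a cheapest one, summing over i gives cost(G) ≤ H_k · cost(OPT).
--
-- Call a path critical if it has maximal length D, and let layer r consist of the vertices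
-- reached from s along a prefix of a critical path of Y-length at most r.  For r < j the sink
-- lies in no layer, so the critical edges leaving layer r form a cut Xᵣ that every critical
-- path crosses, i.e. Xᵣ shortens the project.  If e leaves layer r, its head lies in layer
-- r + Y(e), so e belongs to at most Y(e) of the cuts; hence Σᵣ Xᵣ ≤ Y and the cheapest cut
-- costs at most cost(Y)/j.  A sum-minimal shortening subplan of it crashes by exactly 1.
--
-- Membership in a layer is not evidently decidable, so the cuts are built in the double-negation
-- monad; the final inequality between rationals is decidable, hence stable.
module Submission where

open import Level using (0ℓ)
open import Function using (_∘_)
open import Data.Empty using (⊥-elim)
open import Data.Product using (∃-syntax; _×_; _,_; proj₁; proj₂)
open import Data.Sum using (inj₁; inj₂; [_,_]′)
open import Relation.Binary.PropositionalEquality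
  using (_≡_; _≢_; refl; sym; trans; cong; cong₂; subst; module ≡-Reasoning)
open import Relation.Nullary using (¬_; Dec; yes; no)
open import Relation.Nullary.Decidable using (decidable-stable; ¬¬-excluded-middle; map′)
open import Relation.Nullary.Negation using (¬¬-Monad)
open import Effect.Monad using (RawMonad)
open import Induction.WellFounded using (Acc; acc)
open import Algebra.Bundles using (CommutativeMonoid)
import Algebra.Properties.CommutativeSemigroup as CommutativeSemigroupProperties

open import Data.Nat as ℕ using (ℕ; zero; suc; _+_; _∸_; z≤n; s≤s; _≤_; _<_)
import Data.Nat.Properties as ℕP
open import Data.Nat.Induction using (<-wellFounded)
open import Data.Nat.ListAction using (sum)
open import Data.Nat.ListAction.Properties using (sum-++)
open import Data.Rational as ℚ using (ℚ; 0ℚ; 1ℚ; _/_; toℚᵘ)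
open import Data.Rational using (_*_) renaming (_≤_ to _≤ℚ_)
import Data.Rational.Properties as ℚP
open import Data.Rational.Unnormalised as ℚᵘ using (mkℚᵘ; *≡*)
import Data.Rational.Unnormalised.Properties as ℚᵘP
open import Data.Fin as Fin using (Fin; zero; suc)
open import Data.Fin.Properties using (¬∀⟶∃¬)
open import Data.Vec.Functional using (updateAt)
open import Data.Vec.Functional.Properties using (updateAt-updates; updateAt-minimal)
open import Data.List using (List; []; _∷_; _++_; _∷ʳ_; [_]; map)
open import Data.List.Properties using (map-++; map-cong)
open import Data.List.Membership.Propositional using (_∈_; _∉_)
open import Data.List.Membership.Propositional.Properties using (∈-∃++)
open import Data.List.Relation.Unary.Any using (here; there)

open import Defs

open RawMonad (¬¬-Monad {0ℓ}) using (pure; _>>=_; _<$>_)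

module ℕ+ = CommutativeSemigroupProperties ℕP.+-commutativeSemigroup
module ℚ+ = CommutativeSemigroupProperties (CommutativeMonoid.commutativeSemigroup ℚP.+-0-commutativeMonoid)

exchange-≡ : ∀ {x y x′ y′ D} → x + y ≤ D → x′ + y′ ≤ D → x + y′ ≡ D → x′ + y ≡ D → x + y ≡ D
exchange-≡ {x} {y} {x′} {y′} {D} x+y≤D x′+y′≤D x+y′≡D x′+y≡D =
  ℕP.≤-antisym x+y≤D (ℕP.+-cancelʳ-≤ D D (x + y) (begin
    D + D                ≡⟨ cong₂ _+_ x+y′≡D x′+y≡D ⟨
    (x + y′) + (x′ + y)  ≡⟨ ℕ+.interchange x y′ x′ y ⟩
    (x + x′) + (y′ + y)  ≡⟨ cong ((x + x′) +_) (ℕP.+-comm y′ y) ⟩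
    (x + x′) + (y + y′)  ≡⟨ ℕ+.interchange x x′ y y′ ⟩
    (x + y) + (x′ + y′)  ≤⟨ ℕP.+-monoʳ-≤ (x + y) x′+y′≤D ⟩
    (x + y) + D          ∎))
  where open ℕP.≤-Reasoning

∸-pred≤∸+1 : ∀ x y → x ∸ ℕ.pred y ≤ x ∸ y + 1
∸-pred≤∸+1 x       zero          = ℕP.m≤m+n x 1
∸-pred≤∸+1 zero    (suc y)       = ℕP.≤-trans (ℕP.≤-reflexive (ℕP.0∸n≡0 y)) z≤n
∸-pred≤∸+1 (suc x) (suc zero)    = ℕP.≤-reflexive (ℕP.+-comm 1 x)
∸-pred≤∸+1 (suc x) (suc (suc y)) = ∸-pred≤∸+1 x (suc y)

∸-∸-≤ : ∀ x y z → (x ∸ y) ∸ (z ∸ y) ≤ x ∸ z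
∸-∸-≤ x       zero    z       = ℕP.≤-refl
∸-∸-≤ zero    (suc y) z       = ℕP.≤-trans (ℕP.≤-reflexive (ℕP.0∸n≡0 (z ∸ suc y))) z≤n
∸-∸-≤ (suc x) (suc y) zero    = ℕP.≤-trans (ℕP.m∸n≤m (x ∸ y) 0) (ℕP.≤-trans (ℕP.m∸n≤m x y) (ℕP.n≤1+n x))
∸-∸-≤ (suc x) (suc y) (suc z) = ∸-∸-≤ x y z

∸-∸-comm : ∀ x y z → x ∸ y ∸ z ≡ x ∸ z ∸ y
∸-∸-comm x y z = begin
  x ∸ y ∸ z    ≡⟨ ℕP.∸-+-assoc x y z ⟩
  x ∸ (y + z)  ≡⟨ cong (x ∸_) (ℕP.+-comm y z) ⟩
  x ∸ (z + y)  ≡⟨ ℕP.∸-+-assoc x z y ⟨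
  x ∸ z ∸ y    ∎
  where open ≡-Reasoning

sumℚ-cong : ∀ m {f g : Fin m → ℚ} → (∀ i → f i ≡ g i) → sumℚ m f ≡ sumℚ m g
sumℚ-cong zero    f≗g = refl
sumℚ-cong (suc m) f≗g = cong₂ ℚ._+_ (f≗g zero) (sumℚ-cong m (f≗g ∘ suc))

sumℚ-0 : ∀ m → sumℚ m (λ _ → 0ℚ) ≡ 0ℚ
sumℚ-0 zero    = refl
sumℚ-0 (suc m) = trans (ℚP.+-identityˡ _) (sumℚ-0 m)

sumℚ-+ : ∀ m (f g : Fin m → ℚ) → sumℚ m (λ i → f i ℚ.+ g i) ≡ sumℚ m f ℚ.+ sumℚ m g
sumℚ-+ zero    f g = refl
sumℚ-+ (suc m) f g = trans (cong (f zero ℚ.+ g zero ℚ.+_) (sumℚ-+ m (f ∘ suc) (g ∘ suc)))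
                           (ℚ+.interchange (f zero) (g zero) (sumℚ m (f ∘ suc)) (sumℚ m (g ∘ suc)))

sumℚ-mono-≤ : ∀ m {f g : Fin m → ℚ} → (∀ i → f i ≤ℚ g i) → sumℚ m f ≤ℚ sumℚ m g
sumℚ-mono-≤ zero    f≤g = ℚP.≤-refl
sumℚ-mono-≤ (suc m) f≤g = ℚP.+-mono-≤ (f≤g zero) (sumℚ-mono-≤ m (f≤g ∘ suc))

sumℕ-mono-≤ : ∀ m {f g : Fin m → ℕ} → (∀ i → f i ≤ g i) → sumℕ m f ≤ sumℕ m g
sumℕ-mono-≤ zero    f≤g = z≤n
sumℕ-mono-≤ (suc m) f≤g = ℕP.+-mono-≤ (f≤g zero) (sumℕ-mono-≤ m (f≤g ∘ suc))

sumℕ-mono-< : ∀ m {f g : Fin m → ℕ} i → (∀ i → f i ≤ g i) → f i < g i → sumℕ m f < sumℕ m g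
sumℕ-mono-< (suc m) zero    f≤g fi<gi = ℕP.+-mono-<-≤ fi<gi (sumℕ-mono-≤ m (f≤g ∘ suc))
sumℕ-mono-< (suc m) (suc i) f≤g fi<gi = ℕP.+-mono-≤-< (f≤g zero) (sumℕ-mono-< m i (f≤g ∘ suc) fi<gi)

updateAt-pred-≤ : ∀ {m} (Z : Fin m → ℕ) e f → updateAt Z e ℕ.pred f ≤ Z f
updateAt-pred-≤ Z e f with f Fin.≟ e
... | yes refl = ℕP.≤-trans (ℕP.≤-reflexive (updateAt-updates e Z)) ℕP.pred[n]≤n
... | no  f≢e  = ℕP.≤-reflexive (updateAt-minimal f e Z f≢e)

sumℕ-updateAt-pred-< : ∀ {m} (Z : Fin m → ℕ) e → Z e ≢ 0 → sumℕ m (updateAt Z e ℕ.pred) < sumℕ m Z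
sumℕ-updateAt-pred-< {m} Z e Ze≢0 = sumℕ-mono-< m e (updateAt-pred-≤ Z e)
  (subst (_< Z e) (sym (updateAt-updates e Z)) (ℕP.≤-reflexive (ℕP.suc-pred (Z e) {{ℕ.≢-nonZero Ze≢0}})))

sumℚ< : ℕ → (ℕ → ℚ) → ℚ
sumℚ< zero    a = 0ℚ
sumℚ< (suc k) a = sumℚ< k a ℚ.+ a k

sumℚ<-suc : ∀ k a → sumℚ< (suc k) a ≡ a 0 ℚ.+ sumℚ< k (a ∘ suc)
sumℚ<-suc zero    a = ℚP.+-comm 0ℚ (a 0)
sumℚ<-suc (suc k) a = trans (cong (ℚ._+ a (suc k)) (sumℚ<-suc k a))
                            (ℚP.+-assoc (a 0) (sumℚ< k (a ∘ suc)) (a (suc k)))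

-- ℤ's +_ is opened only here: in scope it makes ℕ sections such as (x +_) ambiguous.
module _ where
  open import Data.Integer as ℤ using (+_)
  import Data.Integer.Properties as ℤP

  -- toℚ n is by definition fromℚᵘ (mkℚᵘ (+ n) 0).
  toℚᵘ-toℚ : ∀ n → toℚᵘ (toℚ n) ℚᵘ.≃ mkℚᵘ (+ n) 0
  toℚᵘ-toℚ n = ℚP.toℚᵘ-fromℚᵘ (mkℚᵘ (+ n) 0)

  toℚ-+ : ∀ x y → toℚ (x + y) ≡ toℚ x ℚ.+ toℚ y
  toℚ-+ x y = ℚP.toℚᵘ-injective (begin
    toℚᵘ (toℚ (x + y))              ≈⟨ toℚᵘ-toℚ (x + y) ⟩
    mkℚᵘ (+ (x + y)) 0              ≈⟨ *≡* integral ⟩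
    mkℚᵘ (+ x) 0 ℚᵘ.+ mkℚᵘ (+ y) 0  ≈⟨ ℚᵘP.+-cong (toℚᵘ-toℚ x) (toℚᵘ-toℚ y) ⟨
    toℚᵘ (toℚ x) ℚᵘ.+ toℚᵘ (toℚ y)  ≈⟨ ℚP.toℚᵘ-homo-+ (toℚ x) (toℚ y) ⟨
    toℚᵘ (toℚ x ℚ.+ toℚ y)          ∎)
    where
    open ℚᵘP.≃-Reasoning
    integral : + (x + y) ℤ.* (+ 1 ℤ.* + 1) ≡ (+ x ℤ.* + 1 ℤ.+ + y ℤ.* + 1) ℤ.* + 1
    integral rewrite ℤP.*-identityʳ (+ x) | ℤP.*-identityʳ (+ y) | ℤP.*-identityʳ (+ x ℤ.+ + y) = refl

  1/suc*toℚ-suc : ∀ k → (+ 1 / suc k) * toℚ (suc k) ≡ 1ℚ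
  1/suc*toℚ-suc k = ℚP.toℚᵘ-injective (begin
    toℚᵘ ((+ 1 / suc k) * toℚ (suc k))          ≈⟨ ℚP.toℚᵘ-homo-* (+ 1 / suc k) (toℚ (suc k)) ⟩
    toℚᵘ (+ 1 / suc k) ℚᵘ.* toℚᵘ (toℚ (suc k))  ≈⟨ ℚᵘP.*-cong (ℚP.toℚᵘ-fromℚᵘ (mkℚᵘ (+ 1) k)) (toℚᵘ-toℚ (suc k)) ⟩
    mkℚᵘ (+ 1) k ℚᵘ.* mkℚᵘ (+ suc k) 0          ≈⟨ *≡* integral ⟩
    toℚᵘ 1ℚ                                     ∎)
    where
    open ℚᵘP.≃-Reasoning
    integral : (+ 1 ℤ.* + suc k) ℤ.* + 1 ≡ + 1 ℤ.* (+ suc k ℤ.* + 1)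
    integral = cong (λ z → + suc z) (trans (ℕP.*-identityʳ (k + 0)) (cong (_+ 0) (sym (ℕP.*-identityʳ k))))

  -- a 0 ≤ C / k pays for the last term 1/k of harmonic k; the tail a ∘ suc meets the hypothesis for k - 1.
  sumℚ<-≤-harmonic* : ∀ k a C → (∀ i → i < k → toℚ (k ∸ i) * a i ≤ℚ C) →
                      sumℚ< k a ≤ℚ harmonic k * C
  sumℚ<-≤-harmonic* zero    a C _     = ℚP.≤-reflexive (sym (ℚP.*-zeroˡ C))
  sumℚ<-≤-harmonic* (suc k) a C bound = begin
    sumℚ< (suc k) a            ≡⟨ sumℚ<-suc k a ⟩
    a 0 ℚ.+ sumℚ< k (a ∘ suc)  ≤⟨ ℚP.+-mono-≤ a0≤ (sumℚ<-≤-harmonic* k (a ∘ suc) C (λ i i<k → bound (suc i) (s≤s i<k))) ⟩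
    u * C ℚ.+ harmonic k * C   ≡⟨ ℚP.+-comm (u * C) _ ⟩
    harmonic k * C ℚ.+ u * C   ≡⟨ ℚP.*-distribʳ-+ C (harmonic k) u ⟨
    harmonic (suc k) * C       ∎
    where
    open ℚP.≤-Reasoning
    u = + 1 / suc k
    a0≤ : a 0 ≤ℚ u * C
    a0≤ = begin
      a 0                      ≡⟨ ℚP.*-identityˡ (a 0) ⟨
      1ℚ * a 0                 ≡⟨ cong (_* a 0) (1/suc*toℚ-suc k) ⟨
      u * toℚ (suc k) * a 0    ≡⟨ ℚP.*-assoc u (toℚ (suc k)) (a 0) ⟩
      u * (toℚ (suc k) * a 0)  ≤⟨ ℚP.*-monoˡ-≤-nonNeg u {{ℚP.normalize-nonNeg 1 (suc k)}} (bound 0 (s≤s z≤n)) ⟩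
      u * C                    ∎

toℚ-nonNeg : ∀ n → 0ℚ ≤ℚ toℚ n
toℚ-nonNeg n = ℚP.nonNegative⁻¹ _ {{ℚP.normalize-nonNeg n 1}}

toℚ-mono-≤ : ∀ {x y} → x ≤ y → toℚ x ≤ℚ toℚ y
toℚ-mono-≤ {x} {y} x≤y = begin
  toℚ x                  ≡⟨ ℚP.+-identityʳ (toℚ x) ⟨
  toℚ x ℚ.+ 0ℚ           ≤⟨ ℚP.+-monoʳ-≤ (toℚ x) (toℚ-nonNeg (y ∸ x)) ⟩
  toℚ x ℚ.+ toℚ (y ∸ x)  ≡⟨ toℚ-+ x (y ∸ x) ⟨
  toℚ (x + (y ∸ x))      ≡⟨ cong toℚ (ℕP.m+[n∸m]≡n x≤y) ⟩
  toℚ y                  ∎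
  where open ℚP.≤-Reasoning

toℚ*≤sumℚ< : ∀ j q f → (∀ r → r < j → q ≤ℚ f r) → toℚ j * q ≤ℚ sumℚ< j f
toℚ*≤sumℚ< zero    q f _     = ℚP.≤-reflexive (ℚP.*-zeroˡ q)
toℚ*≤sumℚ< (suc j) q f q≤f = begin
  toℚ (suc j) * q       ≡⟨ cong (_* q) (trans (toℚ-+ 1 j) (ℚP.+-comm 1ℚ (toℚ j))) ⟩
  (toℚ j ℚ.+ 1ℚ) * q    ≡⟨ ℚP.*-distribʳ-+ q (toℚ j) 1ℚ ⟩
  toℚ j * q ℚ.+ 1ℚ * q  ≡⟨ cong (toℚ j * q ℚ.+_) (ℚP.*-identityˡ q) ⟩
  toℚ j * q ℚ.+ q       ≤⟨ ℚP.+-mono-≤ (toℚ*≤sumℚ< j q f (λ r r<j → q≤f r (ℕP.m≤n⇒m≤1+n r<j))) (q≤f j ℕP.≤-refl) ⟩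
  sumℚ< (suc j) f       ∎
  where open ℚP.≤-Reasoning

argmin< : ∀ {j} → 0 < j → (f : ℕ → ℚ) → ∃[ r ] (r < j × ∀ r′ → r′ < j → f r ≤ℚ f r′)
argmin< {suc zero}    _ f = 0 , ℕP.≤-refl , λ { zero _ → ℚP.≤-refl ; (suc _) (s≤s ()) }
argmin< {suc (suc j)} _ f with argmin< {suc j} (s≤s z≤n) f
... | r , r<1+j , min with ℚP.≤-total (f r) (f (suc j))
...   | inj₁ fr≤ = r , ℕP.m<n⇒m<1+n r<1+j , λ r′ r′<2+j →
  [ min r′ , (λ { refl → fr≤ }) ]′ (ℕP.m<1+n⇒m<n∨m≡n r′<2+j)
...   | inj₂ f[1+j]≤ = suc j , ℕP.≤-refl , λ r′ r′<2+j →
  [ ℚP.≤-trans f[1+j]≤ ∘ min r′ , (λ { refl → ℚP.≤-refl }) ]′ (ℕP.m<1+n⇒m<n∨m≡n r′<2+j)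

indicator : {P : Set} → Dec P → ℕ
indicator (yes _) = 1
indicator (no _)  = 0

module _ {P : ℕ → Set} (P? : ∀ r → Dec (P r)) where

  count : ℕ → ℕ
  count zero    = 0
  count (suc J) = count J + indicator (P? J)

  count-≤-∸ : ∀ J L → (∀ r → r < L → ¬ P r) → count J ≤ J ∸ L
  count-≤-∸ zero    L _ = z≤n
  count-≤-∸ (suc J) L ¬P<L with P? J
  ... | no _   = begin
    count J + 0  ≡⟨ ℕP.+-identityʳ (count J) ⟩
    count J      ≤⟨ count-≤-∸ J L ¬P<L ⟩
    J ∸ L        ≤⟨ ℕP.∸-monoˡ-≤ L (ℕP.n≤1+n J) ⟩
    suc J ∸ L    ∎
    where open ℕP.≤-Reasoning
  ... | yes pJ = begin
    count J + 1  ≤⟨ ℕP.+-monoˡ-≤ 1 (count-≤-∸ J L ¬P<L) ⟩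
    J ∸ L + 1    ≡⟨ ℕP.+-comm (J ∸ L) 1 ⟩
    suc (J ∸ L)  ≡⟨ ℕP.+-∸-assoc 1 (ℕP.≮⇒≥ (λ J<L → ¬P<L J J<L pJ)) ⟨
    suc J ∸ L    ∎
    where open ℕP.≤-Reasoning

  -- When P holds at the last index J, the window confines every r with P r to (J - y, J].
  count-≤-window : ∀ y → (∀ {r r′} → P r → P r′ → r′ < r + y) → ∀ J → count J ≤ y
  count-≤-window y window zero    = z≤n
  count-≤-window y window (suc J) with P? J | count-≤-∸ (suc J) (suc J ∸ y)
  ... | no _   | _     = ℕP.≤-trans (ℕP.≤-reflexive (ℕP.+-identityʳ (count J))) (count-≤-window y window J)
  ... | yes pJ | bound = ℕP.≤-trans (bound outside-window) m∸[m∸y]≤y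
    where
    m∸[m∸y]≤y : suc J ∸ (suc J ∸ y) ≤ y
    m∸[m∸y]≤y = ℕP.m≤n+o⇒m∸n≤o (suc J) (suc J ∸ y) (subst (suc J ≤_) (ℕP.+-comm y _) (ℕP.m≤n+m∸n (suc J) y))
    outside-window : ∀ r → r < suc J ∸ y → ¬ P r
    outside-window r r<J+1-y pr = ℕP.<⇒≱ r<J+1-y
      (ℕP.m≤n+o⇒m∸n≤o (suc J) y (subst (suc J ≤_) (ℕP.+-comm r y) (window pr pJ)))

¬¬-∀-Fin : ∀ n {P : Fin n → Set} → (∀ i → ¬ ¬ P i) → ¬ ¬ (∀ i → P i)
¬¬-∀-Fin zero    _   = pure λ ()
¬¬-∀-Fin (suc n) ¬¬P = do
  p₀ ← ¬¬P zero
  ps ← ¬¬-∀-Fin n (¬¬P ∘ suc)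
  pure λ { zero → p₀ ; (suc i) → ps i }

¬¬-∀< : ∀ j {P : ℕ → Set} → (∀ r → r < j → ¬ ¬ P r) → ¬ ¬ (∀ r → r < j → P r)
¬¬-∀< zero    _   = pure λ _ ()
¬¬-∀< (suc j) ¬¬P = do
  pⱼ  ← ¬¬P j ℕP.≤-refl
  p<j ← ¬¬-∀< j (λ r r<j → ¬¬P r (ℕP.m<n⇒m<1+n r<j))
  pure λ r r<1+j → [ p<j r , (λ { refl → pⱼ }) ]′ (ℕP.m<1+n⇒m<n∨m≡n r<1+j)

¬¬-decide-below : ∀ j m {P : ℕ → Fin m → Set} → ¬ ¬ (∀ r e → Dec (r < j × P r e))
¬¬-decide-below j m = (λ P? r e → dec-× (r ℕP.<? j) (λ r<j → P? r r<j e))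
                      <$> ¬¬-∀< j (λ r _ → ¬¬-∀-Fin m (λ _ → ¬¬-excluded-middle))
  where
  dec-× : ∀ {A B : Set} → Dec A → (A → Dec B) → Dec (A × B)
  dec-× (yes a) B? = map′ (a ,_) proj₂ (B? a)
  dec-× (no ¬a) _  = no (¬a ∘ proj₁)

-- a is offered as minimal; should the continuation exhibit a smaller b′, the search restarts from b′.
¬¬-minimal : {A : Set} (μ : A → ℕ) {Q : A → Set} {a : A} → Q a →
             ¬ ¬ (∃[ b ] (Q b × ∀ b′ → Q b′ → ¬ μ b′ < μ b))
¬¬-minimal μ {Q} {a} qa = go a (<-wellFounded (μ a)) qa
  where
  go : ∀ a → Acc _<_ (μ a) → Q a → ¬ ¬ (∃[ b ] (Q b × ∀ b′ → Q b′ → ¬ μ b′ < μ b))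
  go a (acc smaller) qa ¬min = ¬min (a , qa , λ b′ qb′ μb′<μa → go b′ (smaller μb′<μa) qb′ ¬min)

module Paths (N : Project) where
  open Project N

  Walk : Fin n → List (Fin m) → Fin n → Set
  Walk = IsWalk src tgt

  walk-++ : ∀ {u v w} p {q} → Walk u p v → Walk v q w → Walk u (p ++ q) w
  walk-++ []      refl          wq = wq
  walk-++ (e ∷ p) (srce≡u , wp) wq = srce≡u , walk-++ p wp wq

  walk-++⁻ : ∀ {u w} p {q} → Walk u (p ++ q) w → ∃[ v ] (Walk u p v × Walk v q w)
  walk-++⁻ []      wq             = _ , refl , wq
  walk-++⁻ (e ∷ p) (srce≡u , wpq) with walk-++⁻ p wpq
  ... | v , wp , wq = v , (srce≡u , wp) , wq

  walk-∷ʳ : ∀ {u} p e → Walk u p (src e) → Walk u (p ∷ʳ e) (tgt e)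
  walk-∷ʳ p e wp = walk-++ p wp (refl , refl)

  closed-walk≡[] : ∀ {u} q → Walk u q u → q ≡ []
  closed-walk≡[] []      _ = refl
  closed-walk≡[] (e ∷ q) w = ⊥-elim (acyclic _ e q w)

  walk-∉ : ∀ {v} e p → Walk (tgt e) p v → e ∉ p
  walk-∉ e p w e∈p with q₁ , q₂ , refl ← ∈-∃++ e∈p with walk-++⁻ q₁ w
  ... | v , wq₁ , (srce≡v , _) = acyclic (src e) e q₁ (refl , subst (Walk (tgt e) q₁) (sym srce≡v) wq₁)

  len : Lengths N → List (Fin m) → ℕ
  len = pathLength N

  len-++ : ∀ ℓ p q → len ℓ (p ++ q) ≡ len ℓ p + len ℓ q
  len-++ ℓ p q = trans (cong sum (map-++ ℓ p q)) (sum-++ (map ℓ p) (map ℓ q))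

  len-∷ʳ : ∀ ℓ p e → len ℓ (p ∷ʳ e) ≡ len ℓ p + ℓ e
  len-∷ʳ ℓ p e = trans (len-++ ℓ p [ e ]) (cong (len ℓ p +_) (ℕP.+-identityʳ (ℓ e)))

  len-cong : ∀ {ℓ ℓ′} → (∀ e → ℓ e ≡ ℓ′ e) → ∀ p → len ℓ p ≡ len ℓ′ p
  len-cong ℓ≗ℓ′ p = cong sum (map-cong ℓ≗ℓ′ p)

  len-mono-≤ : ∀ {ℓ ℓ′} → (∀ e → ℓ e ≤ ℓ′ e) → ∀ p → len ℓ p ≤ len ℓ′ p
  len-mono-≤ ℓ≤ℓ′ []      = z≤n
  len-mono-≤ ℓ≤ℓ′ (e ∷ p) = ℕP.+-mono-≤ (ℓ≤ℓ′ e) (len-mono-≤ ℓ≤ℓ′ p)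

  len-accel : ∀ ℓ Z → (∀ e → Z e ≤ ℓ e) → ∀ p → len (accel N ℓ Z) p + len Z p ≡ len ℓ p
  len-accel ℓ Z Z≤ℓ []      = refl
  len-accel ℓ Z Z≤ℓ (e ∷ p) = begin
    (ℓ e ∸ Z e + len (accel N ℓ Z) p) + (Z e + len Z p)  ≡⟨ ℕ+.interchange (ℓ e ∸ Z e) _ (Z e) _ ⟩
    (ℓ e ∸ Z e + Z e) + (len (accel N ℓ Z) p + len Z p)  ≡⟨ cong₂ _+_ (ℕP.m∸n+n≡m (Z≤ℓ e)) (len-accel ℓ Z Z≤ℓ p) ⟩
    ℓ e + len ℓ p                                        ∎
    where open ≡-Reasoning

  len-∈ : ∀ Z {e p} → e ∈ p → Z e ≤ len Z p
  len-∈ Z {p = f ∷ p} (here refl)  = ℕP.m≤m+n (Z f) (len Z p)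
  len-∈ Z {p = f ∷ p} (there e∈p) = ℕP.≤-trans (len-∈ Z e∈p) (ℕP.m≤n+m (len Z p) (Z f))

  len-accel-updateAt-∉ : ∀ ℓ Z {e} p → e ∉ p →
                         len (accel N ℓ (updateAt Z e ℕ.pred)) p ≡ len (accel N ℓ Z) p
  len-accel-updateAt-∉ ℓ Z     []      _   = refl
  len-accel-updateAt-∉ ℓ Z {e} (f ∷ p) e∉p = cong₂ _+_
    (cong (ℓ f ∸_) (updateAt-minimal f e Z (λ f≡e → e∉p (here (sym f≡e)))))
    (len-accel-updateAt-∉ ℓ Z p (e∉p ∘ there))

  -- By acyclicity the decremented edge occurs at most once on the walk.
  len-accel-decrement : ∀ ℓ Z e {u v} p → Walk u p v →
                        len (accel N ℓ (updateAt Z e ℕ.pred)) p ≤ len (accel N ℓ Z) p + 1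
  len-accel-decrement ℓ Z e []      _        = z≤n
  len-accel-decrement ℓ Z e (f ∷ p) (_ , wp) with f Fin.≟ e
  ... | yes refl = begin
    ℓ f ∸ updateAt Z f ℕ.pred f + len (accel N ℓ (updateAt Z f ℕ.pred)) p
      ≡⟨ cong₂ (λ x y → ℓ f ∸ x + y) (updateAt-updates f Z) (len-accel-updateAt-∉ ℓ Z p (walk-∉ f p wp)) ⟩
    ℓ f ∸ ℕ.pred (Z f) + len (accel N ℓ Z) p
      ≤⟨ ℕP.+-monoˡ-≤ _ (∸-pred≤∸+1 (ℓ f) (Z f)) ⟩
    ℓ f ∸ Z f + 1 + len (accel N ℓ Z) p
      ≡⟨ ℕ+.xy∙z≈xz∙y (ℓ f ∸ Z f) 1 _ ⟩
    ℓ f ∸ Z f + len (accel N ℓ Z) p + 1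
      ∎
    where open ℕP.≤-Reasoning
  ... | no f≢e = begin
    ℓ f ∸ updateAt Z e ℕ.pred f + len (accel N ℓ (updateAt Z e ℕ.pred)) p
      ≤⟨ ℕP.+-mono-≤ (ℕP.≤-reflexive (cong (ℓ f ∸_) (updateAt-minimal f e Z f≢e))) (len-accel-decrement ℓ Z e p wp) ⟩
    ℓ f ∸ Z f + (len (accel N ℓ Z) p + 1)
      ≡⟨ ℕP.+-assoc (ℓ f ∸ Z f) _ 1 ⟨
    ℓ f ∸ Z f + len (accel N ℓ Z) p + 1
      ∎
    where open ℕP.≤-Reasoning

  IsDuration-cong : ∀ {ℓ ℓ′ D} → (∀ e → ℓ e ≡ ℓ′ e) → IsDuration N ℓ D → IsDuration N ℓ′ D
  IsDuration-cong ℓ≗ℓ′ ((P , isP , lenP≡D) , longest) =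
    (P , isP , trans (sym (len-cong ℓ≗ℓ′ P)) lenP≡D) ,
    λ P′ isP′ → subst (_≤ _) (len-cong ℓ≗ℓ′ P′) (longest P′ isP′)

  IsDuration-unique : ∀ {ℓ D D′} → IsDuration N ℓ D → IsDuration N ℓ D′ → D ≡ D′
  IsDuration-unique ((P , isP , refl) , longest) ((P′ , isP′ , refl) , longest′) =
    ℕP.≤-antisym (longest′ P isP) (longest P′ isP′)

module Costs (N : Project) where
  open Project N

  cost-zero : cost N (λ _ → 0) ≡ 0ℚ
  cost-zero = trans (sumℚ-cong m (λ e → ℚP.*-zeroʳ (c e))) (sumℚ-0 m)

  cost-+ : ∀ x y → cost N (λ e → x e + y e) ≡ cost N x ℚ.+ cost N y
  cost-+ x y = trans
    (sumℚ-cong m (λ e → trans (cong (c e *_) (toℚ-+ (x e) (y e))) (ℚP.*-distribˡ-+ (c e) (toℚ (x e)) (toℚ (y e)))))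
    (sumℚ-+ m _ _)

  cost-mono-≤ : ∀ {x y} → (∀ e → x e ≤ y e) → cost N x ≤ℚ cost N y
  cost-mono-≤ x≤y = sumℚ-mono-≤ m (λ e → ℚP.*-monoˡ-≤-nonNeg (c e) {{ℚ.nonNegative (c≥0 e)}} (toℚ-mono-≤ (x≤y e)))

  cost-greedyPrefix : ∀ A J → cost N (greedyPrefix N A J) ≡ sumℚ< J (λ i → cost N (A i))
  cost-greedyPrefix A zero    = cost-zero
  cost-greedyPrefix A (suc J) = trans (cost-+ (greedyPrefix N A J) (A J)) (cong (ℚ._+ cost N (A J)) (cost-greedyPrefix A J))

module Shortening (N : Project) {ℓ : Lengths N} {D : ℕ} (durD : IsDuration N ℓ D) where
  open Project N
  open Paths N

  Shortens : Plan N → Set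
  Shortens Z = ∀ P → IsPath N P → len (accel N ℓ Z) P < D

  shortens⇒nonzero : ∀ {Z} → Shortens Z → ¬ (∀ e → Z e ≡ 0)
  shortens⇒nonzero {Z} shortZ Z≡0 =
    let (P , isP , lenP≡D) , _ = durD
    in ℕP.<-irrefl (trans (len-cong (λ e → cong (ℓ e ∸_) (Z≡0 e)) P) lenP≡D) (shortZ P isP)

  ¬shortens⇒¬¬long-path : ∀ {Z} → ¬ Shortens Z → ¬ ¬ (∃[ P ] (IsPath N P × D ≤ len (accel N ℓ Z) P))
  ¬shortens⇒¬¬long-path ¬shortZ ¬long =
    ¬shortZ (λ P isP → decidable-stable (_ ℕP.<? D) (λ ¬P<D → ¬long (P , isP , ℕP.≮⇒≥ ¬P<D)))

  shortens-tight⇒crashing : ∀ {Z} e → Shortens Z → ∀ P → IsPath N P →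
                            D ≤ len (accel N ℓ (updateAt Z e ℕ.pred)) P → Crashing N ℓ 1 Z
  shortens-tight⇒crashing {Z} e shortZ P isP D≤ =
    D , len (accel N ℓ Z) P , durD , durZ , trans (ℕP.+-comm _ 1) 1+lenP≡D
    where
    1+lenP≡D : suc (len (accel N ℓ Z) P) ≡ D
    1+lenP≡D = ℕP.≤-antisym (shortZ P isP)
      (ℕP.≤-trans D≤ (subst (len (accel N ℓ (updateAt Z e ℕ.pred)) P ≤_) (ℕP.+-comm _ 1) (len-accel-decrement ℓ Z e P isP)))
    durZ : IsDuration N (accel N ℓ Z) (len (accel N ℓ Z) P)
    durZ = (P , isP , refl) , λ P′ isP′ → ℕP.≤-pred (subst (_ <_) (sym 1+lenP≡D) (shortZ P′ isP′))

  shortens⇒¬¬crashing-subplan : ∀ {X} → Shortens X → ¬ ¬ (∃[ Z ] ((∀ e → Z e ≤ X e) × Crashing N ℓ 1 Z))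
  shortens⇒¬¬crashing-subplan {X} shortX = do
    Z , (Z≤X , shortZ) , minimal ← ¬¬-minimal (sumℕ m) {Q = ShortSubplan} ((λ _ → ℕP.≤-refl) , shortX)
    let e , Ze≢0 = ¬∀⟶∃¬ m (λ e → Z e ≡ 0) (λ e → Z e ℕP.≟ 0) (shortens⇒nonzero shortZ)
        ¬shortZ⁻ : ¬ Shortens (updateAt Z e ℕ.pred)
        ¬shortZ⁻ shortZ⁻ = minimal (updateAt Z e ℕ.pred)
                                   ((λ f → ℕP.≤-trans (updateAt-pred-≤ Z e f) (Z≤X f)) , shortZ⁻)
                                   (sumℕ-updateAt-pred-< Z e Ze≢0)
    P , isP , D≤ ← ¬shortens⇒¬¬long-path {updateAt Z e ℕ.pred} ¬shortZ⁻
    pure (Z , Z≤X , shortens-tight⇒crashing e shortZ P isP D≤)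
    where
    ShortSubplan : Plan N → Set
    ShortSubplan Z = (∀ e → Z e ≤ X e) × Shortens Z

module Layers (N : Project) {ℓ : Lengths N} {D : ℕ} (durD : IsDuration N ℓ D)
              {Y : Plan N} (Y-valid : ValidPlan N ℓ Y)
              {j : ℕ} (Y-shortens : ∀ P → IsPath N P → pathLength N (accel N ℓ Y) P + j ≤ D) where
  open Project N
  open Paths N
  open Costs N
  open Shortening N durD

  L : List (Fin m) → ℕ
  L = len ℓ

  Y≤ℓ : ∀ e → Y e ≤ ℓ e
  Y≤ℓ e = ℕP.≤-trans (Y-valid e) (ℕP.m∸n≤m (ℓ e) (a e))

  CriticalPrefix : Fin n → List (Fin m) → Set
  CriticalPrefix v p = ∃[ q ] (Walk s p v × Walk v q t × L p + L q ≡ D)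

  CriticalEdge : Fin m → Set
  CriticalEdge e = ∃[ p ] ∃[ q ] (Walk s p (src e) × Walk (tgt e) q t × L p + (ℓ e + L q) ≡ D)

  criticalPrefix-∷ʳ : ∀ {e p} → CriticalPrefix (src e) p → CriticalEdge e → CriticalPrefix (tgt e) (p ∷ʳ e)
  criticalPrefix-∷ʳ {e} {p} (q , wp , wq , crit) (p′ , q′ , wp′ , wq′ , crit′) =
    q′ , walk-∷ʳ p e wp , wq′ , trans (cong (_+ L q′) (len-∷ʳ ℓ p e)) (trans (ℕP.+-assoc (L p) (ℓ e) (L q′)) crit″)
    where
    pathLength≤D : ∀ {u} x y → Walk s x u → Walk u y t → L x + L y ≤ D
    pathLength≤D x y wx wy = subst (_≤ D) (len-++ ℓ x y) (proj₂ durD (x ++ y) (walk-++ x wx wy))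
    crit″ : L p + (ℓ e + L q′) ≡ D
    crit″ = exchange-≡ {L p} {ℓ e + L q′} {L p′} {L q} (pathLength≤D p (e ∷ q′) wp (refl , wq′)) (pathLength≤D p′ q wp′ wq) crit crit′

  Reach : ℕ → Fin n → Set
  Reach r v = ∃[ p ] (CriticalPrefix v p × len Y p ≤ r)

  reach-s : ∀ r → Reach r s
  reach-s r = let (P , isP , lenP≡D) , _ = durD in [] , (P , refl , isP , lenP≡D) , z≤n

  reach-mono : ∀ {r r′ v} → r ≤ r′ → Reach r v → Reach r′ v
  reach-mono r≤r′ (p , crit , Yp≤r) = p , crit , ℕP.≤-trans Yp≤r r≤r′

  reach-step : ∀ {r e} → Reach r (src e) → CriticalEdge e → Reach (r + Y e) (tgt e)
  reach-step {e = e} (p , crit , Yp≤r) critₑ =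
    p ∷ʳ e , criticalPrefix-∷ʳ crit critₑ , subst (_≤ _) (sym (len-∷ʳ Y p e)) (ℕP.+-monoˡ-≤ (Y e) Yp≤r)

  -- Along a critical prefix reaching t, Y would shorten a critical path by at most r < j.
  ¬reach-t : ∀ {r} → r < j → ¬ Reach r t
  ¬reach-t {r} r<j (p , (q , wp , wq , crit) , Yp≤r) with refl ← closed-walk≡[] q wq =
    ℕP.<-irrefl refl (begin-strict
      D                              ≡⟨ trans (sym crit) (ℕP.+-identityʳ (L p)) ⟩
      L p                            ≡⟨ len-accel ℓ Y Y≤ℓ p ⟨
      len (accel N ℓ Y) p + len Y p  ≤⟨ ℕP.+-monoʳ-≤ _ Yp≤r ⟩
      len (accel N ℓ Y) p + r        <⟨ ℕP.+-monoʳ-< _ r<j ⟩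
      len (accel N ℓ Y) p + j        ≤⟨ Y-shortens p wp ⟩
      D                              ∎)
    where open ℕP.≤-Reasoning

  Cut : ℕ → Fin m → Set
  Cut r e = CriticalEdge e × Reach r (src e) × ¬ Reach r (tgt e)

  cut-window : ∀ {r r′ e} → Cut r e → Cut r′ e → r′ < r + Y e
  cut-window (critₑ , reach , _) (_ , _ , ¬reach′) =
    ℕP.≰⇒> (λ r+Y≤r′ → ¬reach′ (reach-mono r+Y≤r′ (reach-step reach critₑ)))

  cut-crossed : ∀ {r} → r < j → ∀ {u} p₁ p₂ → Walk s p₁ u → Walk u p₂ t → L p₁ + L p₂ ≡ D →
                Reach r u → ¬ ¬ (∃[ e ] (e ∈ p₂ × Cut r e))
  cut-crossed r<j p₁ []       _  refl      _    reach = λ _ → ¬reach-t r<j reach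
  cut-crossed r<j p₁ (e ∷ p₂) w₁ (refl , w₂) crit reach = do
    yes reach′ ← ¬¬-excluded-middle
      where no ¬reach′ → pure (e , here refl , (p₁ , p₂ , w₁ , w₂ , crit) , reach , ¬reach′)
    e′ , e′∈p₂ , cut ← cut-crossed r<j (p₁ ∷ʳ e) p₂ (walk-∷ʳ p₁ e w₁) w₂ crit′ reach′
    pure (e′ , there e′∈p₂ , cut)
    where
    crit′ : L (p₁ ∷ʳ e) + L p₂ ≡ D
    crit′ = trans (cong (_+ L p₂) (len-∷ʳ ℓ p₁ e)) (trans (ℕP.+-assoc (L p₁) (ℓ e) (L p₂)) crit)

  module Cuts (cut? : ∀ r e → Dec (r < j × Cut r e)) where

    X : ℕ → Plan N
    X r e = indicator (cut? r e)

    X≤Y : ∀ r e → X r e ≤ Y e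
    X≤Y r e with cut? r e
    ... | yes (_ , cut) = ℕP.+-cancelˡ-< r 0 (Y e) (subst (_< r + Y e) (sym (ℕP.+-identityʳ r)) (cut-window cut cut))
    ... | no _          = z≤n

    X-valid : ∀ r → ValidPlan N ℓ (X r)
    X-valid r e = ℕP.≤-trans (X≤Y r e) (Y-valid e)

    X-shortens : ∀ r → r < j → Shortens (X r)
    X-shortens r r<j P isP with L P ℕP.<? D
    ... | yes LP<D = ℕP.≤-<-trans (len-mono-≤ (λ e → ℕP.m∸n≤m (ℓ e) (X r e)) P) LP<D
    ... | no  LP≮D = decidable-stable (_ ℕP.<? D) do
      e , e∈P , cut ← cut-crossed r<j [] P refl isP LP≡D (reach-s r)
      pure (begin-strict
        len (accel N ℓ (X r)) P                <⟨ ℕP.m<m+n _ (ℕP.≤-trans (1≤X e cut) (len-∈ (X r) e∈P)) ⟩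
        len (accel N ℓ (X r)) P + len (X r) P  ≡⟨ len-accel ℓ (X r) (λ e → ℕP.≤-trans (X≤Y r e) (Y≤ℓ e)) P ⟩
        L P                                    ≡⟨ LP≡D ⟩
        D                                      ∎)
      where
      open ℕP.≤-Reasoning
      LP≡D : L P ≡ D
      LP≡D = ℕP.≤-antisym (proj₂ durD P isP) (ℕP.≮⇒≥ LP≮D)
      1≤X : ∀ e → Cut r e → 1 ≤ X r e
      1≤X e cut with cut? r e
      ... | yes _   = ℕP.≤-refl
      ... | no ¬cut = ⊥-elim (¬cut (r<j , cut))

    greedyPrefix-X≤Y : ∀ e → greedyPrefix N X j e ≤ Y e
    greedyPrefix-X≤Y e = subst (_≤ Y e) (sym (greedyPrefix≡count j))
      (count-≤-window (λ r → cut? r e) (Y e) (λ (_ , cut) (_ , cut′) → cut-window cut cut′) j)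
      where
      greedyPrefix≡count : ∀ J → greedyPrefix N X J e ≡ count (λ r → cut? r e) J
      greedyPrefix≡count zero    = refl
      greedyPrefix≡count (suc J) = cong (_+ X J e) (greedyPrefix≡count J)

    cheapest-cut : ∀ r → (∀ r′ → r′ < j → cost N (X r) ≤ℚ cost N (X r′)) → toℚ j * cost N (X r) ≤ℚ cost N Y
    cheapest-cut r cheapest = begin
      toℚ j * cost N (X r)            ≤⟨ toℚ*≤sumℚ< j _ _ cheapest ⟩
      sumℚ< j (λ r′ → cost N (X r′))  ≡⟨ cost-greedyPrefix X j ⟨
      cost N (greedyPrefix N X j)     ≤⟨ cost-mono-≤ greedyPrefix-X≤Y ⟩
      cost N Y                        ∎
      where open ℚP.≤-Reasoning

  ¬¬-1-crashing-≤-cost/j : 0 < j → ¬ ¬ (∃[ Z ] (ValidPlan N ℓ Z × Crashing N ℓ 1 Z × toℚ j * cost N Z ≤ℚ cost N Y))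
  ¬¬-1-crashing-≤-cost/j 0<j = do
    cut? ← ¬¬-decide-below j m
    let open Cuts cut?
        r , r<j , cheapest = argmin< 0<j (cost N ∘ X)
    Z , Z≤X , crashing ← shortens⇒¬¬crashing-subplan (X-shortens r r<j)
    pure (Z , (λ e → ℕP.≤-trans (Z≤X e) (X-valid r e)) , crashing , (begin
      toℚ j * cost N Z      ≤⟨ ℚP.*-monoˡ-≤-nonNeg (toℚ j) {{ℚ.nonNegative (toℚ-nonNeg j)}} (cost-mono-≤ Z≤X) ⟩
      toℚ j * cost N (X r)  ≤⟨ cheapest-cut r cheapest ⟩
      cost N Y              ∎))
    where open ℚP.≤-Reasoning

minCost-1-crashing-≤-cost/j : ∀ (N : Project) {ℓ D A Y j} → IsDuration N ℓ D → MinCostCrashing N ℓ 1 A →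
                              ValidPlan N ℓ Y → (∀ P → IsPath N P → pathLength N (accel N ℓ Y) P + j ≤ D) →
                              0 < j → toℚ j * cost N A ≤ℚ cost N Y
minCost-1-crashing-≤-cost/j N {A = A} {Y} {j} durD (_ , _ , A-cheapest) Y-valid Y-shortens 0<j =
  decidable-stable (_ ℚP.≤? _) (share <$> Layers.¬¬-1-crashing-≤-cost/j N durD Y-valid Y-shortens 0<j)
  where
  share : ∃[ Z ] (ValidPlan N _ Z × Crashing N _ 1 Z × toℚ j * cost N Z ≤ℚ cost N Y) →
          toℚ j * cost N A ≤ℚ cost N Y
  share (Z , Z-valid , Z-crashing , jZ≤Y) =
    ℚP.≤-trans (ℚP.*-monoˡ-≤-nonNeg (toℚ j) {{ℚ.nonNegative (toℚ-nonNeg j)}} (A-cheapest Z Z-valid Z-crashing)) jZ≤Y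

module Greedy (N : Project) {k : ℕ} {A : ℕ → Plan N}
              (greedy : ∀ i → i < k → MinCostCrashing N (accel N (Project.b N) (greedyPrefix N A i)) 1 (A i)) where
  open Project N
  open Paths N

  G : ℕ → Plan N
  G = greedyPrefix N A

  greedy-duration : ∀ {D} → IsDuration N b D → ∀ i → i ≤ k → ∃[ Dᵢ ] (IsDuration N (accel N b (G i)) Dᵢ × Dᵢ + i ≡ D)
  greedy-duration durD zero    _     = _ , durD , ℕP.+-identityʳ _
  greedy-duration durD (suc i) i<k with greedy-duration durD i (ℕP.<⇒≤ i<k) | greedy i i<k
  ... | Dᵢ , durDᵢ , Dᵢ+i≡D | _ , (E , E′ , durE , durE′ , E′+1≡E) , _ =
    E′ , IsDuration-cong (λ e → ℕP.∸-+-assoc (b e) (G i e) (A i e)) durE′ , (begin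
      E′ + suc i    ≡⟨ ℕP.+-suc E′ i ⟩
      suc (E′ + i)  ≡⟨ cong (_+ i) (trans (ℕP.+-comm 1 E′) E′+1≡E) ⟩
      E + i         ≡⟨ cong (_+ i) (IsDuration-unique durE durDᵢ) ⟩
      Dᵢ + i        ≡⟨ Dᵢ+i≡D ⟩
      _             ∎)
    where open ≡-Reasoning

  residual : Plan N → ℕ → Plan N
  residual OPT i e = OPT e ∸ G i e

  residual-valid : ∀ {OPT} i → ValidPlan N b OPT → ValidPlan N (accel N b (G i)) (residual OPT i)
  residual-valid {OPT} i OPT-valid e =
    subst (OPT e ∸ G i e ≤_) (∸-∸-comm (b e) (a e) (G i e)) (ℕP.∸-monoˡ-≤ (G i e) (OPT-valid e))

  residual-shortens : ∀ {OPT D D′ Dᵢ} i → i ≤ k → IsDuration N (accel N b OPT) D′ → D′ + k ≡ D → Dᵢ + i ≡ D →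
                      ∀ P → IsPath N P → len (accel N (accel N b (G i)) (residual OPT i)) P + (k ∸ i) ≤ Dᵢ
  residual-shortens {OPT} {D′ = D′} {Dᵢ = Dᵢ} i i≤k durD′ D′+k≡D Dᵢ+i≡D P isP = begin
    len (accel N (accel N b (G i)) (residual OPT i)) P + (k ∸ i)
      ≤⟨ ℕP.+-monoˡ-≤ (k ∸ i) (len-mono-≤ (λ e → ∸-∸-≤ (b e) (G i e) (OPT e)) P) ⟩
    len (accel N b OPT) P + (k ∸ i)
      ≤⟨ ℕP.+-monoˡ-≤ (k ∸ i) (proj₂ durD′ P isP) ⟩
    D′ + (k ∸ i)
      ≡⟨ ℕP.+-cancelʳ-≡ i _ _ D′+[k∸i]+i≡Dᵢ+i ⟩
    Dᵢ ∎
    where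
    open ℕP.≤-Reasoning
    D′+[k∸i]+i≡Dᵢ+i : D′ + (k ∸ i) + i ≡ Dᵢ + i
    D′+[k∸i]+i≡Dᵢ+i = trans (ℕP.+-assoc D′ (k ∸ i) i)
      (trans (cong (D′ +_) (ℕP.m∸n+n≡m i≤k)) (trans D′+k≡D (sym Dᵢ+i≡D)))

-- 1 ≤ k and k ≤ k_max(N) only guarantee that OPT exists, which is assumed here.
theorem2p1 : (N : Project) (k : ℕ) → 1 ≤ k →
    (∃[ K ] (IsKMax N K × k ≤ K)) →
    (A : ℕ → Plan N) →
    (∀ i → i < k →
    MinCostCrashing N (accel N (Project.b N) (greedyPrefix N A i)) 1 (A i)) →
    (OPT : Plan N) → MinCostCrashing N (Project.b N) k OPT →
    cost N (greedyPrefix N A k) ≤ℚ (harmonic k * cost N OPT)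
theorem2p1 N k _ _ A greedy OPT (OPT-valid , (D , D′ , durD , durD′ , D′+k≡D) , _) = begin
  cost N (greedyPrefix N A k)   ≡⟨ cost-greedyPrefix A k ⟩
  sumℚ< k (λ i → cost N (A i))  ≤⟨ sumℚ<-≤-harmonic* k _ _ step ⟩
  harmonic k * cost N OPT       ∎
  where
  open ℚP.≤-Reasoning
  open Costs N
  open Greedy N greedy
  step : ∀ i → i < k → toℚ (k ∸ i) * cost N (A i) ≤ℚ cost N OPT
  step i i<k with Dᵢ , durDᵢ , Dᵢ+i≡D ← greedy-duration durD i (ℕP.<⇒≤ i<k) = ℚP.≤-trans
    (minCost-1-crashing-≤-cost/j N durDᵢ (greedy i i<k) (residual-valid i OPT-valid)
      (residual-shortens i (ℕP.<⇒≤ i<k) durD′ D′+k≡D Dᵢ+i≡D) (ℕP.m<n⇒0<n∸m i<k))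
    (cost-mono-≤ (λ e → ℕP.m∸n≤m (OPT e) (G i e)))
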